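{- Let $G$ be a graph having a support vertex $v$ with $\deg_G(v)\geq 3$ such that all neighbors of $v$ except exactly one are leaves. Then $b_{dR}(G)\leq 2$.
   Context: All graphs are finite, simple and undirected. A leaf is a vertex of degree $1$, and a support vertex is the unique neighbor of a leaf. For a graph $G=(V,E)$, a double Roman dominating function (DRDF) is a function $f:V\to\{0,1,2,3\}$ such that every vertex $v$ with $f(v)=0$ has at least two neighbors $u$ with $f(u)=2$ or at least one neighbor $w$ with $f(w)=3$, and every vertex $v$ with $f(v)=1$ has at least one neighbor $w$ with $f(w)\geq 2$. The weight of $f$ is $\sum_{u\in V}f(u)$, and $\gamma_{dR}(G)$ is the minimum weight of a DRDF on $G$. The double Roman bondage number $b_{dR}(G)$ is the minimum cardinality of an edge set $B\subseteq E(G)$ such that $\gamma_{dR}(G-B)>\gamma_{dR}(G)$. -}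

module Defs where

open import Data.Nat using (ℕ; zero; suc; _+_; _≤_; _<_)
open import Data.Fin using (Fin; _≟_)
open import Data.Bool using (Bool; true; false; _∧_; not; if_then_else_)
open import Data.List using (List; map; allFin)
open import Data.Nat.ListAction using (sum)
open import Data.Bool using (_∨_)
open import Data.Bool.Properties using (∨-comm; ∧-comm)
open import Relation.Binary.PropositionalEquality using (cong₂; refl; cong; trans)
open import Data.Product using (Σ; ∃; ∃-syntax; _×_; _,_)
open import Data.Sum using (_⊎_)
open import Relation.Nullary using (¬_)
open import Relation.Nullary.Decidable using (⌊_⌋)
open import Relation.Binary.PropositionalEquality using (_≡_; _≢_)

record Graph : Set where
  field
    n     : ℕ
    adj   : Fin n → Fin n → Bool
    sym   : ∀ u v → adj u v ≡ adj v u
    irref : ∀ v → adj v v ≡ false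
open Graph public

Adj : (G : Graph) → Fin (n G) → Fin (n G) → Set
Adj G u v = adj G u v ≡ true

deg : (G : Graph) → Fin (n G) → ℕ
deg G v = sum (map (λ u → if adj G v u then 1 else 0) (allFin (n G)))

IsLeaf : (G : Graph) → Fin (n G) → Set
IsLeaf G v = deg G v ≡ 1

IsSupport : (G : Graph) → Fin (n G) → Set
IsSupport G v = ∃[ u ] (Adj G v u × IsLeaf G u)

samePair : ∀ {m} → Fin m → Fin m → Fin m → Fin m → Bool
samePair u v a b = (⌊ u ≟ a ⌋ ∧ ⌊ v ≟ b ⌋) ∨ (⌊ u ≟ b ⌋ ∧ ⌊ v ≟ a ⌋)

-- G minus the edge set {{a,b},{c,d}} (a single edge when {a,b} = {c,d})
removeTwo : (G : Graph) → (a b c d : Fin (n G)) → Graph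
removeTwo G a b c d = record
  { n     = n G
  ; adj   = λ u v → adj G u v ∧ not (samePair u v a b ∨ samePair u v c d)
  ; sym   = symProof
  ; irref = irrProof
  }
  where
  samePair-sym : ∀ u v x y → samePair u v x y ≡ samePair v u x y
  samePair-sym u v x y = trans (∨-comm (⌊ u ≟ x ⌋ ∧ ⌊ v ≟ y ⌋) (⌊ u ≟ y ⌋ ∧ ⌊ v ≟ x ⌋))
      (cong₂ _∨_ (∧-comm ⌊ u ≟ y ⌋ ⌊ v ≟ x ⌋) (∧-comm ⌊ u ≟ x ⌋ ⌊ v ≟ y ⌋))
  symProof : ∀ u v → adj G u v ∧ not (samePair u v a b ∨ samePair u v c d) ≡ adj G v u ∧ not (samePair v u a b ∨ samePair v u c d)
  symProof u v = cong₂ _∧_ (sym G u v)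
    (cong not (cong₂ _∨_ (samePair-sym u v a b) (samePair-sym u v c d)))
  irrProof : ∀ v → adj G v v ∧ not (samePair v v a b ∨ samePair v v c d) ≡ false
  irrProof v rewrite irref G v = refl

IsDRDF : (G : Graph) → (Fin (n G) → ℕ) → Set
IsDRDF G f =
  (∀ v → f v ≤ 3) ×
  (∀ v → f v ≡ 0 →
      (∃[ u ] ∃[ w ] (u ≢ w × Adj G v u × Adj G v w × f u ≡ 2 × f w ≡ 2))
    ⊎ (∃[ w ] (Adj G v w × f w ≡ 3))) ×
  (∀ v → f v ≡ 1 → ∃[ w ] (Adj G v w × 2 ≤ f w))

weight : (G : Graph) → (Fin (n G) → ℕ) → ℕ
weight G f = sum (map f (allFin (n G)))

IsγdR : Graph → ℕ → Set
IsγdR G k = (∃[ f ] (IsDRDF G f × weight G f ≡ k)) ×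
            (∀ f → IsDRDF G f → k ≤ weight G f)

-- b_dR(G) ≤ 2 : some edge set B ⊆ E with |B| ≤ 2 has γ_dR(G - B) > γ_dR(G).
-- B = {{a,b},{c,d}} (|B| = 1 if the two edges coincide; B = ∅ never works).
BondageAtMost2 : Graph → Set
BondageAtMost2 G =
  ∃[ a ] ∃[ b ] ∃[ c ] ∃[ d ] (Adj G a b × Adj G c d ×
    (∀ k k' → IsγdR G k → IsγdR (removeTwo G a b c d) k' → k < k'))

-- If v has two leaf neighbours l₁ and l₂, delete the edges vl₁ and vl₂.  In the new
-- graph l₁ and l₂ are isolated, so every DRDF g of it gives each of them at least 2.
-- Reassigning 3 to v and 0 to l₁, l₂ yields a DRDF of G (each l now sees v with value 3,
-- and v itself needs nothing), and it weighs at most w(g) + 3 − 4 < w(g).  Under the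
-- hypotheses, a third neighbour of v exists besides a given leaf l and the non-leaf w,
-- and it must be a leaf.

module Submission where

open import Algebra.Properties.CommutativeMonoid.Sum as Sum using ()
open import Data.Bool using (true; false; _∧_; _∨_; not; if_then_else_)
import Data.Bool.Properties as Bool
open import Data.Bool.Properties using (∧-zeroʳ; ∨-zeroʳ)
open import Data.Fin using (Fin; zero; suc; _≟_)
open import Data.Fin.Properties using (any?; punchInᵢ≢i)
open import Data.List using (map; tabulate; allFin)
open import Data.List.Properties using (map-tabulate)
import Data.Nat as ℕ
open import Data.Nat using (ℕ; zero; suc; _+_; _≤_; _<_; z≤n; s≤s)
open import Data.Nat.Properties
  using (+-0-commutativeMonoid; ≤-refl; ≤-reflexive; ≤-trans; <-irrefl; +-mono-≤; +-monoˡ-≤; +-monoʳ-≤;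
         m≤n+m; m≤m+n; +-identityʳ; +-comm; +-assoc; +-suc; +-cancelʳ-≤; module ≤-Reasoning)
import Data.Nat.ListAction as List
open import Data.Product using (∃-syntax; _×_; _,_)
open import Data.Sum using (_⊎_; inj₁; inj₂)
open import Data.Vec.Functional using (updateAt; removeAt)
open import Data.Vec.Functional.Properties using (updateAt-updates; updateAt-minimal)
open import Function using (const; _∘_)
open import Relation.Binary.PropositionalEquality
  using (_≡_; _≢_; refl; sym; trans; cong; cong₂; subst; module ≡-Reasoning)
open import Relation.Nullary using (¬_; yes; no; contradiction)
open import Relation.Nullary.Decidable using (_×-dec_; ¬?)

open import Defs renaming (sym to adj-sym)
open Sum +-0-commutativeMonoid using (sum; sum-remove; sum-cong-≗; sum-replicate-zero)

infixl 6 _[_]≔_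

_[_]≔_ : ∀ {m} → (Fin m → ℕ) → Fin m → ℕ → Fin m → ℕ
f [ i ]≔ c = updateAt f i (const c)

[]≔-updates : ∀ {m} (f : Fin m → ℕ) i c → (f [ i ]≔ c) i ≡ c
[]≔-updates f i c = updateAt-updates i f

[]≔-minimal : ∀ {m} (f : Fin m → ℕ) {i j} c → j ≢ i → (f [ i ]≔ c) j ≡ f j
[]≔-minimal f {i} {j} c j≢i = updateAt-minimal j i f j≢i

sum-tabulate : ∀ {m} (f : Fin m → ℕ) → List.sum (tabulate f) ≡ sum f
sum-tabulate {zero}  f = refl
sum-tabulate {suc m} f = cong (f zero +_) (sum-tabulate (f ∘ suc))

sum-allFin : ∀ {m} (f : Fin m → ℕ) → List.sum (map f (allFin m)) ≡ sum f
sum-allFin f = trans (cong List.sum (map-tabulate (λ i → i) f)) (sum-tabulate f)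

sum-[]≔ : ∀ {m} (f : Fin m → ℕ) i c → sum (f [ i ]≔ c) + f i ≡ sum f + c
sum-[]≔ {suc m} f i c = begin
  sum (f [ i ]≔ c) + f i                                ≡⟨ cong (_+ f i) (sum-remove {i = i} (f [ i ]≔ c)) ⟩
  (f [ i ]≔ c) i + sum (removeAt (f [ i ]≔ c) i) + f i   ≡⟨ cong₂ (λ x y → x + y + f i) ([]≔-updates f i c) rest ⟩
  c + sum (removeAt f i) + f i                          ≡⟨ +-comm (c + _) (f i) ⟩
  f i + (c + sum (removeAt f i))                        ≡⟨ cong (f i +_) (+-comm c _) ⟩
  f i + (sum (removeAt f i) + c)                        ≡⟨ sym (+-assoc (f i) _ c) ⟩
  f i + sum (removeAt f i) + c                          ≡⟨ cong (_+ c) (sym (sum-remove f)) ⟩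
  sum f + c                                             ∎
  where
  open ≡-Reasoning
  rest : sum (removeAt (f [ i ]≔ c) i) ≡ sum (removeAt f i)
  rest = sum-cong-≗ (λ j → []≔-minimal f c (punchInᵢ≢i i j))

sum-[]≔0 : ∀ {m} (f : Fin m → ℕ) i → sum (f [ i ]≔ 0) + f i ≡ sum f
sum-[]≔0 f i = trans (sum-[]≔ f i 0) (+-identityʳ (sum f))

[]≔0-≤ : ∀ {m} (f : Fin m → ℕ) i j → (f [ i ]≔ 0) j ≤ f j
[]≔0-≤ f i j with j ≟ i
... | yes refl = subst (_≤ f j) (sym ([]≔-updates f j 0)) z≤n
... | no j≢i   = ≤-reflexive ([]≔-minimal f 0 j≢i)

sum-≥-point : ∀ {m} (f : Fin m → ℕ) i → f i ≤ sum f
sum-≥-point f i = subst (f i ≤_) (sum-[]≔0 f i) (m≤n+m (f i) _)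

sum-≥-pair : ∀ {m} (f : Fin m → ℕ) {i j} → i ≢ j → f i + f j ≤ sum f
sum-≥-pair f {i} {j} i≢j = begin
  f i + f j               ≡⟨ cong (f i +_) (sym ([]≔-minimal f 0 (i≢j ∘ sym))) ⟩
  f i + (f [ i ]≔ 0) j    ≤⟨ +-monoʳ-≤ (f i) (sum-≥-point (f [ i ]≔ 0) j) ⟩
  f i + sum (f [ i ]≔ 0)  ≡⟨ +-comm (f i) _ ⟩
  sum (f [ i ]≔ 0) + f i  ≡⟨ sum-[]≔0 f i ⟩
  sum f                   ∎
  where open ≤-Reasoning

sum-≤-pair : ∀ {m} (f : Fin m → ℕ) i j → (∀ k → k ≢ i → k ≢ j → f k ≡ 0) → sum f ≤ f i + f j
sum-≤-pair {m} f i j vanishes = begin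
  sum f                           ≡⟨ sym (sum-[]≔0 f i) ⟩
  sum f₁ + f i                    ≡⟨ cong (_+ f i) (sym (sum-[]≔0 f₁ j)) ⟩
  sum (f₁ [ j ]≔ 0) + f₁ j + f i  ≡⟨ cong (λ s → s + f₁ j + f i) cleared ⟩
  f₁ j + f i                      ≤⟨ +-monoˡ-≤ (f i) ([]≔0-≤ f i j) ⟩
  f j + f i                       ≡⟨ +-comm (f j) (f i) ⟩
  f i + f j                       ∎
  where
  open ≤-Reasoning
  f₁ : Fin m → ℕ
  f₁ = f [ i ]≔ 0
  vanishes′ : ∀ k → (f₁ [ j ]≔ 0) k ≡ 0
  vanishes′ k with k ≟ j | k ≟ i
  ... | yes refl | _        = []≔-updates f₁ k 0
  ... | no k≢j   | yes refl = trans ([]≔-minimal f₁ 0 k≢j) ([]≔-updates f k 0)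
  ... | no k≢j   | no k≢i   = trans ([]≔-minimal f₁ 0 k≢j) (trans ([]≔-minimal f 0 k≢i) (vanishes k k≢i k≢j))
  cleared : sum (f₁ [ j ]≔ 0) ≡ 0
  cleared = trans (sum-cong-≗ vanishes′) (sum-replicate-zero m)

Adj⇒≢ : ∀ G {x y} → Adj G x y → x ≢ y
Adj⇒≢ G {x} x~y refl = contradiction (trans (sym (irref G x)) x~y) λ ()

Adj-sym : ∀ G {x y} → Adj G x y → Adj G y x
Adj-sym G {x} {y} x~y = trans (adj-sym G y x) x~y

sum-raise-one-clear-two-< : ∀ {m} (g : Fin m → ℕ) {v l₁ l₂} → l₁ ≢ v → l₂ ≢ v → l₂ ≢ l₁ →
                            2 ≤ g l₁ → 2 ≤ g l₂ → sum (g [ v ]≔ 3 [ l₁ ]≔ 0 [ l₂ ]≔ 0) < sum g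
sum-raise-one-clear-two-< {m} g {v} {l₁} {l₂} l₁≢v l₂≢v l₂≢l₁ 2≤gl₁ 2≤gl₂ = +-cancelʳ-≤ 3 _ _ (begin
  suc (sum h) + 3              ≡⟨ +-suc (sum h) 3 ⟨
  sum h + (2 + 2)              ≤⟨ +-monoʳ-≤ (sum h) (+-mono-≤ 2≤gl₂ 2≤gl₁) ⟩
  sum h + (g l₂ + g l₁)        ≡⟨ cong (sum h +_) (cong₂ _+_ f₂l₂≡gl₂ f₁l₁≡gl₁) ⟨
  sum h + (f₂ l₂ + f₁ l₁)      ≡⟨ +-assoc (sum h) _ _ ⟨
  sum h + f₂ l₂ + f₁ l₁        ≡⟨ cong (_+ f₁ l₁) (sum-[]≔0 f₂ l₂) ⟩
  sum f₂ + f₁ l₁               ≡⟨ sum-[]≔0 f₁ l₁ ⟩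
  sum f₁                       ≤⟨ m≤m+n (sum f₁) (g v) ⟩
  sum f₁ + g v                 ≡⟨ sum-[]≔ g v 3 ⟩
  sum g + 3                    ∎)
  where
  open ≤-Reasoning
  f₁ f₂ h : Fin m → ℕ
  f₁ = g [ v ]≔ 3
  f₂ = f₁ [ l₁ ]≔ 0
  h  = f₂ [ l₂ ]≔ 0
  f₁l₁≡gl₁ : f₁ l₁ ≡ g l₁
  f₁l₁≡gl₁ = []≔-minimal g 3 l₁≢v
  f₂l₂≡gl₂ : f₂ l₂ ≡ g l₂
  f₂l₂≡gl₂ = trans ([]≔-minimal f₁ 0 l₂≢l₁) ([]≔-minimal g 3 l₂≢v)

adjacency : (G : Graph) → Fin (n G) → Fin (n G) → ℕ
adjacency G v u = if adj G v u then 1 else 0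

deg≡sum-adjacency : ∀ G v → deg G v ≡ sum (adjacency G v)
deg≡sum-adjacency G v = sum-allFin (adjacency G v)

adjacency-≤1 : ∀ G v u → adjacency G v u ≤ 1
adjacency-≤1 G v u with adj G v u
... | true  = ≤-refl
... | false = z≤n

Adj⇒adjacency≡1 : ∀ G {v u} → Adj G v u → adjacency G v u ≡ 1
Adj⇒adjacency≡1 G v~u rewrite v~u = refl

¬Adj⇒adjacency≡0 : ∀ G {v u} → ¬ Adj G v u → adjacency G v u ≡ 0
¬Adj⇒adjacency≡0 G {v} {u} v≁u with adj G v u
... | true  = contradiction refl v≁u
... | false = refl

deg-≥2 : ∀ G {v u u′} → u ≢ u′ → Adj G v u → Adj G v u′ → 2 ≤ deg G v
deg-≥2 G {v} {u} {u′} u≢u′ v~u v~u′ = begin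
  2                                     ≡⟨ cong₂ _+_ (Adj⇒adjacency≡1 G v~u) (Adj⇒adjacency≡1 G v~u′) ⟨
  adjacency G v u + adjacency G v u′    ≤⟨ sum-≥-pair (adjacency G v) u≢u′ ⟩
  sum (adjacency G v)                   ≡⟨ deg≡sum-adjacency G v ⟨
  deg G v                               ∎
  where open ≤-Reasoning

deg-≤2 : ∀ G {v} a b → (∀ u → u ≢ a → u ≢ b → ¬ Adj G v u) → deg G v ≤ 2
deg-≤2 G {v} a b others = begin
  deg G v                             ≡⟨ deg≡sum-adjacency G v ⟩
  sum (adjacency G v)                 ≤⟨ sum-≤-pair (adjacency G v) a b vanishes ⟩
  adjacency G v a + adjacency G v b   ≤⟨ +-mono-≤ (adjacency-≤1 G v a) (adjacency-≤1 G v b) ⟩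
  2                                   ∎
  where
  open ≤-Reasoning
  vanishes : ∀ u → u ≢ a → u ≢ b → adjacency G v u ≡ 0
  vanishes u u≢a u≢b = ¬Adj⇒adjacency≡0 G (others u u≢a u≢b)

leaf-neighbour-unique : ∀ G {l u u′} → IsLeaf G l → Adj G l u → Adj G l u′ → u ≡ u′
leaf-neighbour-unique G {u = u} {u′} leaf l~u l~u′ with u ≟ u′
... | yes u≡u′ = u≡u′
... | no u≢u′  = contradiction (subst (2 ≤_) leaf (deg-≥2 G u≢u′ l~u l~u′)) (<-irrefl refl)

third-neighbour : ∀ G {v} → 3 ≤ deg G v → ∀ a b → ∃[ u ] (Adj G v u × u ≢ a × u ≢ b)
third-neighbour G {v} 3≤deg a b
  with any? (λ u → (adj G v u Bool.≟ true) ×-dec (¬? (u ≟ a) ×-dec ¬? (u ≟ b)))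
... | yes found = found
... | no none   = contradiction (≤-trans 3≤deg (deg-≤2 G a b λ u u≢a u≢b v~u → none (u , v~u , u≢a , u≢b)))
                                (<-irrefl refl)

ZeroCondition : (G : Graph) → (Fin (n G) → ℕ) → Fin (n G) → Set
ZeroCondition G f x =
  (∃[ u ] ∃[ w ] (u ≢ w × Adj G x u × Adj G x w × f u ≡ 2 × f w ≡ 2)) ⊎ (∃[ w ] (Adj G x w × f w ≡ 3))

OneCondition : (G : Graph) → (Fin (n G) → ℕ) → Fin (n G) → Set
OneCondition G f x = ∃[ w ] (Adj G x w × 2 ≤ f w)

IsDRDF-isolated-≥2 : ∀ G {f l} → IsDRDF G f → (∀ y → ¬ Adj G l y) → 2 ≤ f l
IsDRDF-isolated-≥2 G {f} {l} (_ , zero-ok , one-ok) isolated with f l in fl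
... | zero with zero-ok l fl
...   | inj₁ (u , _ , _ , l~u , _) = contradiction l~u (isolated u)
...   | inj₂ (w , l~w , _)         = contradiction l~w (isolated w)
IsDRDF-isolated-≥2 G {f} {l} (_ , zero-ok , one-ok) isolated | suc zero with one-ok l fl
...   | w , l~w , _ = contradiction l~w (isolated w)
IsDRDF-isolated-≥2 G {f} {l} _ isolated | suc (suc _) = s≤s (s≤s z≤n)

IsDRDF-raise : ∀ G {f} v → IsDRDF G f → IsDRDF G (f [ v ]≔ 3)
IsDRDF-raise G {f} v (bounded , zero-ok , one-ok) = bounded′ , zero-ok′ , one-ok′
  where
  f′ : Fin (n G) → ℕ
  f′ = f [ v ]≔ 3
  raised : ∀ x → f′ x ≡ 3 ⊎ f′ x ≡ f x
  raised x with x ≟ v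
  ... | yes refl = inj₁ ([]≔-updates f x 3)
  ... | no x≢v   = inj₂ ([]≔-minimal f 3 x≢v)
  bounded′ : ∀ x → f′ x ≤ 3
  bounded′ x with raised x
  ... | inj₁ f′x≡3 = ≤-reflexive f′x≡3
  ... | inj₂ f′x≡fx = subst (_≤ 3) (sym f′x≡fx) (bounded x)
  zero-ok′ : ∀ x → f′ x ≡ 0 → ZeroCondition G f′ x
  zero-ok′ x f′x≡0 with raised x
  ... | inj₁ f′x≡3  = contradiction (trans (sym f′x≡3) f′x≡0) λ ()
  ... | inj₂ f′x≡fx = keep (zero-ok x (trans (sym f′x≡fx) f′x≡0))
    where
    keep : ZeroCondition G f x → ZeroCondition G f′ x
    keep (inj₂ (w , x~w , fw≡3)) with raised w
    ... | inj₁ f′w≡3  = inj₂ (w , x~w , f′w≡3)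
    ... | inj₂ f′w≡fw = inj₂ (w , x~w , trans f′w≡fw fw≡3)
    keep (inj₁ (u , w , u≢w , x~u , x~w , fu≡2 , fw≡2)) with raised u | raised w
    ... | inj₁ f′u≡3  | _           = inj₂ (u , x~u , f′u≡3)
    ... | inj₂ _      | inj₁ f′w≡3  = inj₂ (w , x~w , f′w≡3)
    ... | inj₂ f′u≡fu | inj₂ f′w≡fw =
          inj₁ (u , w , u≢w , x~u , x~w , trans f′u≡fu fu≡2 , trans f′w≡fw fw≡2)
  one-ok′ : ∀ x → f′ x ≡ 1 → OneCondition G f′ x
  one-ok′ x f′x≡1 with raised x
  ... | inj₁ f′x≡3  = contradiction (trans (sym f′x≡3) f′x≡1) λ ()
  ... | inj₂ f′x≡fx = keep (one-ok x (trans (sym f′x≡fx) f′x≡1))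
    where
    keep : OneCondition G f x → OneCondition G f′ x
    keep (w , x~w , 2≤fw) with raised w
    ... | inj₁ f′w≡3  = w , x~w , subst (2 ≤_) (sym f′w≡3) (s≤s (s≤s z≤n))
    ... | inj₂ f′w≡fw = w , x~w , subst (2 ≤_) (sym f′w≡fw) 2≤fw

IsDRDF-[leaf]≔0 : ∀ G {f l v} → IsDRDF G f → IsLeaf G l → Adj G l v → f v ≡ 3 → IsDRDF G (f [ l ]≔ 0)
IsDRDF-[leaf]≔0 G {f} {l} {v} (bounded , zero-ok , one-ok) leaf l~v fv≡3 = bounded′ , zero-ok′ , one-ok′
  where
  f′ : Fin (n G) → ℕ
  f′ = f [ l ]≔ 0
  -- Only v sees l, and v carries 3, so no vertex that still needs a witness loses one.
  unseen : ∀ {x y} → f x ≤ 1 → Adj G x y → f′ y ≡ f y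
  unseen {x} {y} fx≤1 x~y with y ≟ l
  ... | yes refl = contradiction (subst (λ z → f z ≤ 1) (leaf-neighbour-unique G leaf (Adj-sym G x~y) l~v) fx≤1)
                                 (subst (λ k → ¬ k ≤ 1) (sym fv≡3) λ { (s≤s ()) })
  ... | no y≢l   = []≔-minimal f 0 y≢l
  bounded′ : ∀ x → f′ x ≤ 3
  bounded′ x with x ≟ l
  ... | yes refl = subst (_≤ 3) (sym ([]≔-updates f x 0)) z≤n
  ... | no x≢l   = subst (_≤ 3) (sym ([]≔-minimal f 0 x≢l)) (bounded x)
  zero-ok′ : ∀ x → f′ x ≡ 0 → ZeroCondition G f′ x
  zero-ok′ x f′x≡0 with x ≟ l
  ... | yes refl = inj₂ (v , l~v , trans ([]≔-minimal f 0 (Adj⇒≢ G l~v ∘ sym)) fv≡3)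
  ... | no x≢l   = keep (zero-ok x fx≡0)
    where
    fx≡0 : f x ≡ 0
    fx≡0 = trans (sym ([]≔-minimal f 0 x≢l)) f′x≡0
    fx≤1 : f x ≤ 1
    fx≤1 = subst (_≤ 1) (sym fx≡0) z≤n
    keep : ZeroCondition G f x → ZeroCondition G f′ x
    keep (inj₁ (u , w , u≢w , x~u , x~w , fu≡2 , fw≡2)) =
      inj₁ (u , w , u≢w , x~u , x~w , trans (unseen fx≤1 x~u) fu≡2 , trans (unseen fx≤1 x~w) fw≡2)
    keep (inj₂ (w , x~w , fw≡3)) = inj₂ (w , x~w , trans (unseen fx≤1 x~w) fw≡3)
  one-ok′ : ∀ x → f′ x ≡ 1 → OneCondition G f′ x
  one-ok′ x f′x≡1 with x ≟ l
  ... | yes refl = contradiction (trans (sym ([]≔-updates f x 0)) f′x≡1) λ ()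
  ... | no x≢l   = keep (one-ok x fx≡1)
    where
    fx≡1 : f x ≡ 1
    fx≡1 = trans (sym ([]≔-minimal f 0 x≢l)) f′x≡1
    keep : OneCondition G f x → OneCondition G f′ x
    keep (w , x~w , 2≤fw) = w , x~w , subst (2 ≤_) (sym (unseen (≤-reflexive fx≡1) x~w)) 2≤fw

samePair-refl : ∀ {m} (a b : Fin m) → samePair a b a b ≡ true
samePair-refl a b with a ≟ a | b ≟ b
... | yes _  | yes _  = refl
... | no a≢a | _      = contradiction refl a≢a
... | _      | no b≢b = contradiction refl b≢b

module _ (G : Graph) (a b c d : Fin (n G)) where

  private
    H : Graph
    H = removeTwo G a b c d

  removeTwo-⊆ : ∀ {x y} → Adj H x y → Adj G x y
  removeTwo-⊆ {x} {y} x~y with adj G x y | x~y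
  ... | true  | _  = refl
  ... | false | ()

  removeTwo-deletes₁ : ¬ Adj H a b
  removeTwo-deletes₁ a~b = contradiction (trans (sym a~b) deleted) λ ()
    where
    deleted : adj G a b ∧ not (samePair a b a b ∨ samePair a b c d) ≡ false
    deleted rewrite samePair-refl a b = ∧-zeroʳ (adj G a b)

  removeTwo-deletes₂ : ¬ Adj H c d
  removeTwo-deletes₂ c~d = contradiction (trans (sym c~d) deleted) λ ()
    where
    deleted : adj G c d ∧ not (samePair c d a b ∨ samePair c d c d) ≡ false
    deleted rewrite samePair-refl c d | ∨-zeroʳ (samePair c d a b) = ∧-zeroʳ (adj G c d)

  removeTwo-isolates-leaf : ∀ {l v} → IsLeaf G l → Adj G l v → ¬ Adj H v l → ∀ y → ¬ Adj H l y
  removeTwo-isolates-leaf leaf l~v v≁l y l~y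
    with leaf-neighbour-unique G leaf l~v (removeTwo-⊆ l~y)
  ... | refl = v≁l (Adj-sym H l~y)

  removeTwo-IsDRDF : ∀ {f} → IsDRDF H f → IsDRDF G f
  removeTwo-IsDRDF {f} (bounded , zero-ok , one-ok) = bounded , zero-ok′ , one-ok′
    where
    zero-ok′ : ∀ x → f x ≡ 0 → ZeroCondition G f x
    zero-ok′ x fx≡0 with zero-ok x fx≡0
    ... | inj₁ (u , w , u≢w , x~u , x~w , fu≡2 , fw≡2) =
          inj₁ (u , w , u≢w , removeTwo-⊆ x~u , removeTwo-⊆ x~w , fu≡2 , fw≡2)
    ... | inj₂ (w , x~w , fw≡3) = inj₂ (w , removeTwo-⊆ x~w , fw≡3)
    one-ok′ : ∀ x → f x ≡ 1 → OneCondition G f x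
    one-ok′ x fx≡1 with one-ok x fx≡1
    ... | w , x~w , 2≤fw = w , removeTwo-⊆ x~w , 2≤fw

twoLeaves⇒BondageAtMost2 : ∀ G {v l₁ l₂} → l₁ ≢ l₂ → Adj G v l₁ → Adj G v l₂ →
                           IsLeaf G l₁ → IsLeaf G l₂ → BondageAtMost2 G
twoLeaves⇒BondageAtMost2 G {v} {l₁} {l₂} l₁≢l₂ v~l₁ v~l₂ leaf₁ leaf₂ =
  v , l₁ , v , l₂ , v~l₁ , v~l₂ , λ _ _ → increases
  where
  G′ : Graph
  G′ = removeTwo G v l₁ v l₂
  l₁≢v : l₁ ≢ v
  l₁≢v = Adj⇒≢ G v~l₁ ∘ sym
  l₂≢v : l₂ ≢ v
  l₂≢v = Adj⇒≢ G v~l₂ ∘ sym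
  increases : ∀ {k k′} → IsγdR G k → IsγdR G′ k′ → k < k′
  increases (_ , optimal) ((g , g-DRDF , refl) , _) = begin-strict
    _            ≤⟨ optimal h h-DRDF ⟩
    weight G h   ≡⟨ sum-allFin h ⟩
    sum h        <⟨ sum-raise-one-clear-two-< g l₁≢v l₂≢v (l₁≢l₂ ∘ sym) (2≤g leaf₁ v~l₁ deletes₁)
                                                              (2≤g leaf₂ v~l₂ deletes₂) ⟩
    sum g        ≡⟨ sum-allFin g ⟨
    weight G′ g  ∎
    where
    open ≤-Reasoning
    h : Fin (n G) → ℕ
    h = g [ v ]≔ 3 [ l₁ ]≔ 0 [ l₂ ]≔ 0
    h-DRDF : IsDRDF G h
    h-DRDF = IsDRDF-[leaf]≔0 G
               (IsDRDF-[leaf]≔0 G (IsDRDF-raise G v (removeTwo-IsDRDF G v l₁ v l₂ g-DRDF))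
                                  leaf₁ (Adj-sym G v~l₁) ([]≔-updates g v 3))
               leaf₂ (Adj-sym G v~l₂) (trans ([]≔-minimal (g [ v ]≔ 3) 0 (l₁≢v ∘ sym)) ([]≔-updates g v 3))
    deletes₁ : ¬ Adj G′ v l₁
    deletes₁ = removeTwo-deletes₁ G v l₁ v l₂
    deletes₂ : ¬ Adj G′ v l₂
    deletes₂ = removeTwo-deletes₂ G v l₁ v l₂
    2≤g : ∀ {l} → IsLeaf G l → Adj G v l → ¬ Adj G′ v l → 2 ≤ g l
    2≤g leaf v~l v≁l =
      IsDRDF-isolated-≥2 G′ g-DRDF (removeTwo-isolates-leaf G v l₁ v l₂ leaf (Adj-sym G v~l) v≁l)

corollary3p3 : (G : Graph) (v : Fin (n G)) →
    IsSupport G v → 3 ≤ deg G v →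
    (∃[ w ] (Adj G v w × ¬ IsLeaf G w × (∀ u → Adj G v u → ¬ IsLeaf G u → u ≡ w))) →
    BondageAtMost2 G
corollary3p3 G v (l , v~l , leaf-l) 3≤deg (w , _ , _ , only-w) with third-neighbour G 3≤deg l w
... | u , v~u , u≢l , u≢w with deg G u ℕ.≟ 1
...   | yes leaf-u    = twoLeaves⇒BondageAtMost2 G (u≢l ∘ sym) v~l v~u leaf-l leaf-u
...   | no nonleaf-u  = contradiction (only-w u v~u nonleaf-u) u≢w
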